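{- Let $T$ be an infinite tree (connected, acyclic, locally finite) with maximum degree at least three and finite metric dimension. Then $$\beta(T)=\sum_{v:\ \deg(v)\ge 3}\max\{P_T(v)-1,0\},$$ and all metric bases of $T$ can be obtained as follows: for each vertex $v$ with $P_T(v)=k\ge 2$, select $k-1$ vertices different from $v$ lying on distinct branch paths of $T$ at $v$.
   Context: $d(u,v)$ is the shortest-path distance. A vertex $x$ resolves $u,v$ if $d(u,x)\neq d(v,x)$; a set $S$ of vertices is a resolving set if every pair of distinct vertices is resolved by some vertex of $S$; a metric basis is a resolving set of minimum cardinality, and $\beta(T)$ (the metric dimension) is its cardinality when a finite resolving set exists. For a vertex $v$ of a tree $T$, a branch of $T$ at $v$ is a maximal subtree of $T$ having $v$ as a leaf. A branch path of $T$ at $v$ is a branch at $v$ that is either a finite path or a one-way infinite path (a graph with vertices $u_0,u_1,u_2,\dots$ and edges $u_iu_{i+1}$, $i\ge 0$). $P_T(v)$ denotes the number of branch paths of $T$ at $v$. -}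

module Defs where

open import Data.Nat using (ℕ; zero; suc; _≤_; _∸_; _+_)
open import Data.List using (List; []; _∷_; length)
open import Data.List.Membership.Propositional using (_∈_; _∉_)
open import Data.List.Relation.Unary.Unique.Propositional using (Unique)
open import Data.Product using (Σ; ∃; _×_; _,_)
open import Relation.Nullary using (¬_)
open import Data.Empty using (⊥)
open import Relation.Binary.PropositionalEquality using (_≡_; _≢_)
open import Function.Bundles using (_⇔_)

-- A locally finite (simple, undirected) graph: each vertex has a finite
-- list of neighbours.
record Graph : Set₁ where
  field
    V     : Set
    nb    : V → List V
    nb-unique : ∀ v → Unique (nb v)
    nb-irrefl : ∀ v → v ∉ nb v
    nb-sym    : ∀ u v → u ∈ nb v → v ∈ nb u

module _ (G : Graph) where
  open Graph G

  deg : V → ℕ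
  deg v = length (nb v)

  data Walk : V → V → ℕ → Set where
    here : ∀ {u} → Walk u u 0
    step : ∀ {u w v n} → w ∈ nb u → Walk w v n → Walk u v (suc n)

  Dist : V → V → ℕ → Set
  Dist u v n = Walk u v n × (∀ m → Walk u v m → n ≤ m)

  Connected : Set
  Connected = ∀ u v → ∃ λ n → Walk u v n

  data IsPathList : List V → Set where
    one  : ∀ {x} → IsPathList (x ∷ [])
    cons : ∀ {x y xs} → y ∈ nb x → IsPathList (y ∷ xs) → IsPathList (x ∷ y ∷ xs)

  data LastIs : List V → V → Set where
    one  : ∀ {z} → LastIs (z ∷ []) z
    cons : ∀ {x ys z} → LastIs ys z → LastIs (x ∷ ys) z

  Acyclic : Set
  Acyclic = ∀ (x₀ : V) (xs : List V) (xₖ : V) →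
            2 ≤ length xs →
            Unique (x₀ ∷ xs) →
            IsPathList (x₀ ∷ xs) →
            LastIs (x₀ ∷ xs) xₖ → x₀ ∈ nb xₖ → ⊥

  IsTree : Set
  IsTree = Connected × Acyclic

  InfiniteGraph : Set
  InfiniteGraph = ∀ (L : List V) → ∃ λ v → v ∉ L

  data ReachAvoid (v : V) : V → V → Set where
    here : ∀ {w} → w ≢ v → ReachAvoid v w w
    step : ∀ {w w' u} → w ≢ v → w' ∈ nb w → ReachAvoid v w' u → ReachAvoid v w u

  -- for a neighbour w of v, the branch at v containing w consists of v
  -- together with the component of T - v containing w.
  InBranch : V → V → V → Set
  InBranch v w u = ReachAvoid v w u

  -- the branch at v through w is a (finite or one-way infinite) path:
  -- every vertex of it other than the leaf v has degree ≤ 2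
  -- (degrees in the branch agree with degrees in T for vertices ≠ v).
  BranchPath : V → V → Set
  BranchPath v w = ∀ u → InBranch v w u → deg u ≤ 2

  data Count {A : Set} (P : A → Set) : List A → ℕ → Set where
    []  : Count P [] 0
    yes : ∀ {x xs n} → P x → Count P xs n → Count P (x ∷ xs) (suc n)
    no  : ∀ {x xs n} → ¬ P x → Count P xs n → Count P (x ∷ xs) n

  NumBranchPaths : V → ℕ → Set
  NumBranchPaths v k = Count (BranchPath v) (nb v) k

  Resolves : V → V → V → Set
  Resolves x u v = ∀ m n → Dist u x m → Dist v x n → m ≢ n

  -- finite vertex sets are duplicate-free lists
  Resolving : List V → Set
  Resolving S = ∀ u v → u ≢ v → ∃ λ x → x ∈ S × Resolves x u v

  FiniteMetricDim : Set
  FiniteMetricDim = ∃ λ S → Unique S × Resolving S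

  MetricBasis : List V → Set
  MetricBasis S = Unique S × Resolving S ×
                  (∀ S' → Unique S' → Resolving S' → length S ≤ length S')

  MetricDim : ℕ → Set
  MetricDim n = ∃ λ S → MetricBasis S × length S ≡ n

  data BranchSum : List V → ℕ → Set where
    []    : BranchSum [] 0
    big   : ∀ {v vs k m} → 3 ≤ deg v → NumBranchPaths v k → BranchSum vs m →
            BranchSum (v ∷ vs) ((k ∸ 1) + m)
    small : ∀ {v vs m} → ¬ (3 ≤ deg v) → BranchSum vs m → BranchSum (v ∷ vs) m

  OnBranchPath : V → V → Set
  OnBranchPath v u = ∃ λ w → w ∈ nb v × BranchPath v w × InBranch v w u

  -- S is obtained by the construction: for each v with P_T(v) = k ≥ 2,
  -- exactly k-1 elements of S lie on branch paths at v, on pairwise distinct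
  -- ones (none equals v, automatically); and S consists of such vertices only.
  Constructed : List V → Set
  Constructed S =
    Unique S ×
    (∀ v k → NumBranchPaths v k → 2 ≤ k →
       Count (OnBranchPath v) S (k ∸ 1) ×
       (∀ u u' w w' → u ∈ S → u' ∈ S → u ≢ u' →
          w ∈ nb v → w' ∈ nb v → BranchPath v w → BranchPath v w' →
          InBranch v w u → InBranch v w' u' → w ≢ w')) ×
    (∀ u → u ∈ S → ∃ λ v → ∃ λ k → NumBranchPaths v k × 2 ≤ k × OnBranchPath v u)

{-# OPTIONS --safe #-}

-- In a tree the distance is the length of the unique non-backtracking path, and for a neighbour a
-- of c the branch at c through a is {x | d a x < d c x}.  A nonempty S is resolving iff it meets
-- one of any two branches at a common vertex: vertices at odd distance are resolved by parity,
-- and vertices at even distance lie in different branches at their midpoint.  A finite resolving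
-- set leaves only finitely many vertices of degree at least 3 (major vertices), and each branch
-- path at a major vertex contains no other one.  A resolving set meets all but at most one branch
-- path at every major vertex, and branch paths at different major vertices are disjoint, whence
-- |S| ≥ Σ (P_T(v) - 1).  Conversely, a set meeting all but one branch path at every vertex meets
-- all but one branch everywhere: a missed branch containing a major vertex would contain a
-- smaller missed branch with the same property.  So the construction yields resolving sets of
-- exactly that size, and the bases are the sets attaining the bound at every vertex.

module Submission where

open import Defs hiding (yes; no)
open import Data.Nat using (ℕ; zero; suc; _≤_; _<_; _+_; _*_; _∸_; z≤n; s≤s; _≤?_; _<?_)
open import Data.Nat.Properties hiding (_≟_)
open import Data.Nat.ListAction using (sum)
open import Data.List
  using (List; []; _∷_; _++_; _∷ʳ_; length; drop; map; filter; concatMap; deduplicate; InitLast; initLast; _∷ʳ′_)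
open import Data.List.Properties
  using (length-++; length-map; length-drop; length-filter; filter-all; filter-some; filter-none; filter-notAll; filter-complete)
open import Data.List.Membership.Propositional using (_∈_; find; lose)
open import Data.List.Membership.Propositional.Properties
  using (∈-filter⁺; ∈-filter⁻; ∈-map⁺; ∈-map⁻; ∈-++⁺ˡ; ∈-++⁺ʳ; ∈-concatMap⁺; ∈-concatMap⁻; ∈-deduplicate⁺; ∈-deduplicate⁻)
open import Data.List.Relation.Unary.Unique.DecPropositional.Properties using (deduplicate-!)
open import Data.List.Relation.Binary.Subset.Propositional using (_⊆_)
open import Data.List.Relation.Unary.All as All using (All; []; _∷_)
import Data.List.Relation.Unary.All.Properties as All
open import Data.List.Relation.Unary.Any as Any using (Any; here; there; any?)
open import Data.List.Relation.Unary.AllPairs using ([]; _∷_)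
open import Data.List.Relation.Unary.Unique.Propositional using (Unique)
import Data.List.Relation.Unary.Unique.Propositional.Properties as Unique
open import Data.Product using (Σ; ∃; _×_; _,_; proj₁; proj₂)
open import Data.Empty using (⊥; ⊥-elim)
open import Data.Unit using (⊤; tt)
open import Data.Sum using (_⊎_; inj₁; inj₂; [_,_])
open import Function using (_∘_)
open import Level using (0ℓ)
open import Relation.Nullary using (¬_; ¬?; Dec; yes; no; contradiction; _×-dec_)
import Relation.Nullary.Decidable as Dec
open import Relation.Nullary.Decidable using (decidable-stable)
open import Function.Bundles using (_⇔_; mk⇔)
open import Relation.Unary using (Pred; Decidable)
open import Relation.Unary.Properties using (∁?)
open import Relation.Binary.Definitions using (DecidableEquality)
open import Relation.Binary.PropositionalEquality hiding ([_])

-- Counting in lists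

module _ {A : Set} where

  count : {P : Pred A 0ℓ} → Decidable P → List A → ℕ
  count P? xs = length (filter P? xs)

  module _ {P : Pred A 0ℓ} (P? : Decidable P) where

    count-∁ : ∀ xs → count P? xs + count (∁? P?) xs ≡ length xs
    count-∁ [] = refl
    count-∁ (x ∷ xs) with P? x
    ... | yes _ = cong suc (count-∁ xs)
    ... | no _ = trans (+-suc _ _) (cong suc (count-∁ xs))

    count≡length⇒all : ∀ {xs x} → count P? xs ≡ length xs → x ∈ xs → P x
    count≡length⇒all {xs} e m = proj₂ (∈-filter⁻ P? {xs = xs} (subst (_ ∈_) (sym (filter-complete P? e)) m))

    count≡0⇒none : ∀ {xs x} → count P? xs ≡ 0 → x ∈ xs → ¬ P x
    count≡0⇒none {xs} e m px with filter P? xs | ∈-filter⁺ P? {xs = xs} m px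
    ... | _ ∷ _ | _ = 0≢1+n (sym e)

    2≤count⇒distinct : ∀ {xs} → Unique xs → 2 ≤ count P? xs →
                       ∃ λ a → ∃ λ b → a ∈ xs × b ∈ xs × P a × P b × a ≢ b
    2≤count⇒distinct {xs} !xs le with filter P? xs in eq | Unique.filter⁺ P? !xs | le
    ... | a ∷ b ∷ _ | (a≢b ∷ _) ∷ _ | _ =
      let (a∈ , pa) = ∈-filter⁻ P? (subst (a ∈_) (sym eq) (here refl))
          (b∈ , pb) = ∈-filter⁻ P? (subst (b ∈_) (sym eq) (there (here refl)))
      in a , b , a∈ , b∈ , pa , pb , a≢b
    ... | _ ∷ [] | _ | s≤s ()

    count≤1 : ∀ {xs} → Unique xs → (∀ {a b} → a ∈ xs → b ∈ xs → P a → P b → a ≡ b) → count P? xs ≤ 1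
    count≤1 {xs} !xs same with 2 ≤? count P? xs
    ... | no ≱2 = ≤-pred (≰⇒> ≱2)
    ... | yes le with 2≤count⇒distinct !xs le
    ...   | _ , _ , a∈ , b∈ , pa , pb , a≢b = contradiction (same a∈ b∈ pa pb) a≢b

  Unique⇒≟ : ∀ {xs : List A} {x y} → Unique xs → x ∈ xs → y ∈ xs → Dec (x ≡ y)
  Unique⇒≟ _ (here refl) (here refl) = yes refl
  Unique⇒≟ (x∉ ∷ _) (here refl) (there y∈) = no (λ x≡y → All.lookup x∉ (subst (_∈ _) (sym x≡y) y∈) refl)
  Unique⇒≟ (y∉ ∷ _) (there x∈) (here refl) = no (λ x≡y → All.lookup y∉ (subst (_∈ _) x≡y x∈) refl)
  Unique⇒≟ (_ ∷ !xs) (there x∈) (there y∈) = Unique⇒≟ !xs x∈ y∈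

  Unique-map : ∀ {f : A → A} {xs} → Unique xs →
               (∀ {x x'} → x ∈ xs → x' ∈ xs → x ≢ x' → f x ≢ f x') → Unique (map f xs)
  Unique-map {xs = []} _ _ = []
  Unique-map {f} {x ∷ xs} (x∉ ∷ !xs) inj =
    All.tabulate (λ m → let (z , z∈ , e) = ∈-map⁻ f m in λ e' → inj (here refl) (there z∈) (All.lookup x∉ z∈) (trans e' e))
    ∷ Unique-map !xs (λ m m' → inj (there m) (there m'))

  Unique-map⁻ : ∀ {f : A → A} {xs x x'} → Unique (map f xs) → x ∈ xs → x' ∈ xs → f x ≡ f x' → x ≡ x'
  Unique-map⁻ _ (here refl) (here refl) _ = refl
  Unique-map⁻ {f} (fx∉ ∷ _) (here refl) (there m') e = ⊥-elim (All.lookup fx∉ (∈-map⁺ f m') e)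
  Unique-map⁻ {f} (fx∉ ∷ _) (there m) (here refl) e = ⊥-elim (All.lookup fx∉ (∈-map⁺ f m) (sym e))
  Unique-map⁻ (_ ∷ !fxs) (there m) (there m') e = Unique-map⁻ !fxs m m' e

  three-distinct : ∀ {xs : List A} → Unique xs → 3 ≤ length xs →
                   ∃ λ a → ∃ λ b → ∃ λ c → a ∈ xs × b ∈ xs × c ∈ xs × a ≢ b × a ≢ c × b ≢ c
  three-distinct {a ∷ b ∷ c ∷ _} ((a≢b ∷ a≢c ∷ _) ∷ (b≢c ∷ _) ∷ _) _ =
    a , b , c , here refl , there (here refl) , there (there (here refl)) , a≢b , a≢c , b≢c
  three-distinct {_ ∷ []} _ (s≤s ())
  three-distinct {_ ∷ _ ∷ []} _ (s≤s (s≤s ()))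

  count-⊎ : ∀ {P Q R : Pred A 0ℓ} (P? : Decidable P) (Q? : Decidable Q) (R? : Decidable R) →
            (∀ {x} → R x → P x ⊎ Q x) → (∀ {x} → P x ⊎ Q x → R x) → (∀ {x} → P x → ¬ Q x) →
            ∀ xs → count R? xs ≡ count P? xs + count Q? xs
  count-⊎ P? Q? R? R⇒ ⇒R disj [] = refl
  count-⊎ P? Q? R? R⇒ ⇒R disj (x ∷ xs) with R? x | P? x | Q? x | count-⊎ P? Q? R? R⇒ ⇒R disj xs
  ... | yes _  | yes _  | no _   | ih = cong suc ih
  ... | yes _  | no _   | yes _  | ih = trans (cong suc ih) (sym (+-suc _ _))
  ... | no _   | no _   | no _   | ih = ih
  ... | yes r  | no ¬p  | no ¬q  | _  = ⊥-elim ([ ¬p , ¬q ] (R⇒ r))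
  ... | no ¬r  | yes p  | _      | _  = ⊥-elim (¬r (⇒R (inj₁ p)))
  ... | no ¬r  | no _   | yes q  | _  = ⊥-elim (¬r (⇒R (inj₂ q)))
  ... | _      | yes p  | yes q  | _  = ⊥-elim (disj p q)

  sum-map-mono : ∀ {f g : A → ℕ} L → (∀ {v} → v ∈ L → f v ≤ g v) → sum (map f L) ≤ sum (map g L)
  sum-map-mono [] _ = z≤n
  sum-map-mono (v ∷ L) f≤g = +-mono-≤ (f≤g (here refl)) (sum-map-mono L (f≤g ∘ there))

  sum-map-cong : ∀ {f g : A → ℕ} L → (∀ {v} → v ∈ L → f v ≡ g v) → sum (map f L) ≡ sum (map g L)
  sum-map-cong [] _ = refl
  sum-map-cong (v ∷ L) f≡g = cong₂ _+_ (f≡g (here refl)) (sum-map-cong L (f≡g ∘ there))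

  sum-map-tight : ∀ {f g : A → ℕ} L → (∀ {v} → v ∈ L → f v ≤ g v) → sum (map g L) ≤ sum (map f L) →
                  ∀ {v} → v ∈ L → f v ≡ g v
  sum-map-tight {f} {g} (v ∷ L) f≤g Σg≤Σf (here refl) = ≤-antisym (f≤g (here refl)) g≤f
    where
      g≤f : g v ≤ f v
      g≤f = +-cancelʳ-≤ _ _ _ (≤-trans Σg≤Σf (+-monoʳ-≤ (f v) (sum-map-mono L (f≤g ∘ there))))
  sum-map-tight {f} {g} (v ∷ L) f≤g Σg≤Σf (there m) = sum-map-tight L (f≤g ∘ there) Σg≤Σf′ m
    where
      Σg≤Σf′ : sum (map g L) ≤ sum (map f L)
      Σg≤Σf′ = +-cancelˡ-≤ (g v) _ _ (≤-trans Σg≤Σf (+-monoˡ-≤ _ (f≤g (here refl))))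

even-or-odd : ∀ m → (Σ ℕ λ h → m ≡ h + h) ⊎ (Σ ℕ λ h → m ≡ suc (h + h))
even-or-odd zero = inj₁ (0 , refl)
even-or-odd (suc m) with even-or-odd m
... | inj₁ (h , e) = inj₂ (h , cong suc e)
... | inj₂ (h , e) = inj₁ (suc h , trans (cong suc e) (cong suc (sym (+-suc h h))))

module _ {A : Set} (_≟_ : DecidableEquality A) where

  Unique⇒length≤ : ∀ {xs ys : List A} → Unique xs → xs ⊆ ys → length xs ≤ length ys
  Unique⇒length≤ {[]} _ _ = z≤n
  Unique⇒length≤ {x ∷ xs} {ys} (x∉xs ∷ !xs) xs⊆ys = begin-strict
    length xs               ≤⟨ Unique⇒length≤ !xs xs⊆others ⟩
    length (filter x≢? ys)  <⟨ filter-notAll x≢? ys (Any.map (λ x≡y x≢y → x≢y x≡y) (xs⊆ys (here refl))) ⟩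
    length ys               ∎
    where
      open ≤-Reasoning
      x≢? : Decidable (x ≢_)
      x≢? y = ¬? (x ≟ y)
      xs⊆others : xs ⊆ filter x≢? ys
      xs⊆others m = ∈-filter⁺ x≢? (xs⊆ys (there m)) (All.lookup x∉xs m)

  length-minimal⇒Unique : ∀ (xs : List A) → (∀ ys → xs ⊆ ys → length xs ≤ length ys) → Unique xs
  length-minimal⇒Unique [] _ = []
  length-minimal⇒Unique (x ∷ xs) minimal =
    All.tabulate (λ {z} z∈xs x≡z → 1+n≰n (minimal xs (λ { (here refl) → subst (_∈ xs) (sym x≡z) z∈xs ; (there m) → m })))
    ∷ length-minimal⇒Unique xs
        (λ ys xs⊆ys → ≤-pred (minimal (x ∷ ys) (λ { (here refl) → here refl ; (there m) → there (xs⊆ys m) })))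

  module _ {P Q : Pred A 0ℓ} (P? : Decidable P) (Q? : Decidable Q) {xs : List A} (!xs : Unique xs)
           (P⇒Q : ∀ {x} → x ∈ xs → P x → Q x) where

    private
      filter⊆ : filter P? xs ⊆ filter Q? xs
      filter⊆ m = let (x∈ , px) = ∈-filter⁻ P? {xs = xs} m in ∈-filter⁺ Q? x∈ (P⇒Q x∈ px)

    count-mono : count P? xs ≤ count Q? xs
    count-mono = Unique⇒length≤ (Unique.filter⁺ P? !xs) filter⊆

    count-mono-< : ∀ {y} → y ∈ xs → Q y → ¬ P y → count P? xs < count Q? xs
    count-mono-< {y} y∈ qy ¬py = Unique⇒length≤ (All.tabulate y≢ ∷ Unique.filter⁺ P? !xs)
      λ { (here refl) → ∈-filter⁺ Q? y∈ qy ; (there m) → filter⊆ m }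
      where
        y≢ : ∀ {z} → z ∈ filter P? xs → y ≢ z
        y≢ m refl = ¬py (proj₂ (∈-filter⁻ P? {xs = xs} m))

module _ {A B : Set} {P : A → B → Set} (P? : ∀ v u → Dec (P v u)) where

  count-sum : ∀ {L} → Unique L → (∀ {v v' u} → v ∈ L → v' ∈ L → P v u → P v' u → v ≡ v') →
              ∀ S → sum (map (λ v → count (P? v) S) L) ≡ count (λ u → any? (λ v → P? v u) L) S
  count-sum {[]} _ _ S = sym (cong length (filter-none _ {xs = S} (All.tabulate (λ _ ()))))
  count-sum {v ∷ L} (v∉L ∷ !L) functional S =
    trans (cong (count (P? v) S +_) (count-sum !L (λ m m' → functional (there m) (there m')) S))
          (sym (count-⊎ (P? v) (λ u → any? (λ v → P? v u) L) (λ u → any? (λ v → P? v u) (v ∷ L))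
                  (λ { (here p) → inj₁ p ; (there q) → inj₂ q }) [ here , there ]
                  (λ p q → let (v' , v'∈ , p') = find q in All.lookup v∉L v'∈ (functional (here refl) (there v'∈) p p'))
                  S))

module Counting (G : Graph) where
  open Graph G using (V)

  module _ {P : Pred V 0ℓ} where

    count-Count : (P? : Decidable P) → ∀ xs → Count G P xs (count P? xs)
    count-Count P? [] = []
    count-Count P? (x ∷ xs) with P? x
    ... | yes px = Count.yes px (count-Count P? xs)
    ... | no ¬px = Count.no ¬px (count-Count P? xs)

    Count⇒≡count : (P? : Decidable P) → ∀ {xs n} → Count G P xs n → n ≡ count P? xs
    Count⇒≡count P? [] = refl
    Count⇒≡count P? {x ∷ _} (Count.yes px c) with P? x
    ... | yes _ = cong suc (Count⇒≡count P? c)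
    ... | no ¬px = contradiction px ¬px
    Count⇒≡count P? {x ∷ _} (Count.no ¬px c) with P? x
    ... | yes px = contradiction px ¬px
    ... | no _ = Count⇒≡count P? c

  module _ {P Q : Pred V 0ℓ} where

    Count-cong : ∀ {xs n} → (∀ {x} → x ∈ xs → P x → Q x) → (∀ {x} → x ∈ xs → Q x → P x) →
                 Count G P xs n → Count G Q xs n
    Count-cong P⇒Q Q⇒P [] = []
    Count-cong P⇒Q Q⇒P (Count.yes px c) = Count.yes (P⇒Q (here refl) px) (Count-cong (P⇒Q ∘ there) (Q⇒P ∘ there) c)
    Count-cong P⇒Q Q⇒P (Count.no ¬px c) = Count.no (¬px ∘ Q⇒P (here refl)) (Count-cong (P⇒Q ∘ there) (Q⇒P ∘ there) c)

-- The metric of a tree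

module TreeMetric (G : Graph) (conn : Connected G) (acyc : Acyclic G) where
  open Graph G
  open Counting G

  endpoint : V → List V → V
  endpoint u [] = u
  endpoint u (x ∷ xs) = endpoint x xs

  endpoint∈ : ∀ u xs → endpoint u xs ∈ u ∷ xs
  endpoint∈ u [] = here refl
  endpoint∈ u (x ∷ xs) = there (endpoint∈ x xs)

  adjacent⇒≢ : ∀ {x y} → y ∈ nb x → x ≢ y
  adjacent⇒≢ {x} y∈ refl = nb-irrefl x y∈

  data NonBacktracking : List V → Set where
    one  : ∀ {x} → NonBacktracking (x ∷ [])
    two  : ∀ {x y} → y ∈ nb x → NonBacktracking (x ∷ y ∷ [])
    more : ∀ {x y z r} → y ∈ nb x → x ≢ z → NonBacktracking (y ∷ z ∷ r) → NonBacktracking (x ∷ y ∷ z ∷ r)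

  NB-tail : ∀ {x y r} → NonBacktracking (x ∷ y ∷ r) → NonBacktracking (y ∷ r)
  NB-tail (two _) = one
  NB-tail (more _ _ p) = p

  NB-adjacent : ∀ {x y r} → NonBacktracking (x ∷ y ∷ r) → y ∈ nb x
  NB-adjacent (two a) = a
  NB-adjacent (more a _ _) = a

  NB-init : ∀ x m z → NonBacktracking (x ∷ m ∷ʳ z) → NonBacktracking (x ∷ m)
  NB-init x [] z p = one
  NB-init x (y ∷ []) z (more a _ _) = two a
  NB-init x (y ∷ y' ∷ m) z (more a x≢ p) = more a x≢ (NB-init y (y' ∷ m) z p)

  NB-last-adjacent : ∀ x m z → NonBacktracking (x ∷ m ∷ʳ z) → z ∈ nb (endpoint x m)
  NB-last-adjacent x [] z (two a) = a
  NB-last-adjacent x (y ∷ m) z p = NB-last-adjacent y m z (NB-tail p)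

  NB⇒IsPathList : ∀ {L} → NonBacktracking L → IsPathList G L
  NB⇒IsPathList one = one
  NB⇒IsPathList (two a) = cons a one
  NB⇒IsPathList (more a _ p) = cons a (NB⇒IsPathList p)

  endpoint-LastIs : ∀ x m → LastIs G (x ∷ m) (endpoint x m)
  endpoint-LastIs x [] = one
  endpoint-LastIs x (y ∷ m) = cons (endpoint-LastIs y m)

  -- A non-backtracking walk whose distinct prefix returns to its start would close a cycle.
  NB-head≢last : ∀ x m z → NonBacktracking (x ∷ m ∷ʳ z) → Unique (x ∷ m) → x ≢ z
  NB-head≢last x [] z (two a) _ = adjacent⇒≢ a
  NB-head≢last x (y ∷ []) z (more _ x≢z _) _ = x≢z
  NB-head≢last x (y ∷ y' ∷ m) .x p !xm refl =
    acyc x (y ∷ y' ∷ m) (endpoint y' m) (s≤s (s≤s z≤n)) !xm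
      (NB⇒IsPathList (NB-init x (y ∷ y' ∷ m) x p)) (endpoint-LastIs x (y ∷ y' ∷ m))
      (NB-last-adjacent x (y ∷ y' ∷ m) x p)

  NB⇒Unique : ∀ {L} → NonBacktracking L → Unique L
  NB⇒Unique {L} = bounded (length L) L ≤-refl
    where
      bounded : ∀ n L → length L ≤ n → NonBacktracking L → Unique L
      snoc : ∀ n x {w} → InitLast w → length w ≤ n → NonBacktracking (x ∷ w) → Unique (x ∷ w)
      bounded (suc n) (x ∷ w) len p = snoc n x (initLast w) (≤-pred len) p
      snoc n x [] _ _ = [] ∷ []
      snoc n x (m ∷ʳ′ z) len p = All.∷ʳ⁺ x∉m (NB-head≢last x m z p !xm) ∷ bounded n (m ∷ʳ z) len (tail m p)
        where
          !xm : Unique (x ∷ m)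
          !xm = bounded n (x ∷ m) (≤-trans (≤-reflexive (trans (+-comm 1 (length m)) (sym (length-++ m)))) len) (NB-init x m z p)
          x∉m : All (x ≢_) m
          x∉m with !xm
          ... | x∉ ∷ _ = x∉
          tail : ∀ m → NonBacktracking (x ∷ m ∷ʳ z) → NonBacktracking (m ∷ʳ z)
          tail [] _ = one
          tail (_ ∷ _) p = NB-tail p

  -- Cancelling each immediate return shortens a walk by an even amount.
  record Reduction (u v : V) (n : ℕ) : Set where
    constructor reduction
    field
      path   : List V
      nb-path : NonBacktracking (u ∷ path)
      ends   : endpoint u path ≡ v
      excess : ℕ
      length≡ : length path + 2 * excess ≡ n

  reduce : ∀ {u v n} → Walk G u v n → Reduction u v n
  reduce here = reduction [] one refl 0 refl
  reduce {u} (step {w = w} u~w walk) with reduce walk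
  ... | reduction [] _ ends k len = reduction (w ∷ []) (two u~w) ends k (cong suc len)
  ... | reduction (y ∷ ys) p ends k len with Unique⇒≟ (nb-unique w) (nb-sym w u u~w) (NB-adjacent p)
  ...   | yes refl = reduction ys (NB-tail p) ends (suc k) (trans (cancel (length ys) k) (cong suc len))
    where
      cancel : ∀ a k → a + 2 * suc k ≡ suc (suc a + 2 * k)
      cancel a k = trans (cong (a +_) (*-suc 2 k)) (trans (+-suc a _) (cong suc (+-suc a _)))
  ...   | no u≢y = reduction (w ∷ y ∷ ys) (more u~w u≢y p) ends k (cong suc len)

  FirstStepsDiffer : List V → List V → Set
  FirstStepsDiffer _ [] = ⊤
  FirstStepsDiffer [] (_ ∷ _) = ⊤
  FirstStepsDiffer (x ∷ _) (y ∷ _) = x ≢ y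

  -- Reverse the first path onto the second; no backtracking arises at the junction a.
  NB-join : ∀ a xs ys → NonBacktracking (a ∷ xs) → NonBacktracking (a ∷ ys) → FirstStepsDiffer xs ys →
            Σ (List V) λ t → NonBacktracking (endpoint a xs ∷ t) × endpoint (endpoint a xs) t ≡ endpoint a ys
                             × length t ≡ length xs + length ys
  NB-join a [] ys _ q _ = ys , q , refl , refl
  NB-join a (x ∷ xs) ys p q differ with NB-join x xs (a ∷ ys) (NB-tail p) (extend ys q differ) (differ′ xs p)
    where
      x~a : a ∈ nb x
      x~a = nb-sym x a (NB-adjacent p)
      extend : ∀ ys → NonBacktracking (a ∷ ys) → FirstStepsDiffer (x ∷ xs) ys → NonBacktracking (x ∷ a ∷ ys)
      extend [] _ _ = two x~a
      extend (y ∷ ys) q x≢y = more x~a x≢y q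
      differ′ : ∀ xs → NonBacktracking (a ∷ x ∷ xs) → FirstStepsDiffer xs (a ∷ ys)
      differ′ [] _ = tt
      differ′ (_ ∷ _) (more _ a≢ _) = a≢ ∘ sym
  ... | t , r , ends , len = t , r , ends , trans len (+-suc (length xs) (length ys))

  NB-ends-differ : ∀ {h y ys} → NonBacktracking (h ∷ y ∷ ys) → h ≢ endpoint y ys
  NB-ends-differ {y = y} {ys} p with NB⇒Unique p
  ... | h∉ ∷ _ = All.lookup h∉ (endpoint∈ y ys)

  infix 4 _≟_
  _≟_ : DecidableEquality V
  u ≟ v with reduce (proj₂ (conn u v))
  ... | reduction [] _ ends _ _ = yes ends
  ... | reduction (_ ∷ _) p ends _ _ = no (λ u≡v → NB-ends-differ p (trans u≡v (sym ends)))

  open import Data.List.Membership.DecPropositional _≟_ using (_∈?_)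

  NB-path-unique : ∀ {u} xs ys → NonBacktracking (u ∷ xs) → NonBacktracking (u ∷ ys) →
                   endpoint u xs ≡ endpoint u ys → xs ≡ ys
  NB-path-unique [] [] _ _ _ = refl
  NB-path-unique [] (_ ∷ _) _ q e = ⊥-elim (NB-ends-differ q e)
  NB-path-unique (_ ∷ _) [] p _ e = ⊥-elim (NB-ends-differ p (sym e))
  NB-path-unique {u} (x ∷ xs) (y ∷ ys) p q e with x ≟ y
  ... | yes refl = cong (x ∷_) (NB-path-unique xs ys (NB-tail p) (NB-tail q) e)
  ... | no x≢y with NB-join u (x ∷ xs) (y ∷ ys) p q x≢y
  ...   | _ ∷ _ , r , ends , _ = ⊥-elim (NB-ends-differ r (trans e (sym ends)))

  geodesic : ∀ u v → Reduction u v (proj₁ (conn u v))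
  geodesic u v = reduce (proj₂ (conn u v))

  NB⇒Walk : ∀ {u} xs → NonBacktracking (u ∷ xs) → Walk G u (endpoint u xs) (length xs)
  NB⇒Walk [] _ = here
  NB⇒Walk (x ∷ xs) p = step (NB-adjacent p) (NB⇒Walk xs (NB-tail p))

  opaque
    d : V → V → ℕ
    d u v = length (Reduction.path (geodesic u v))

    NB⇒d≡length : ∀ {u v} xs → NonBacktracking (u ∷ xs) → endpoint u xs ≡ v → d u v ≡ length xs
    NB⇒d≡length {u} {v} xs p ends′ = cong length (NB-path-unique path xs nb-path p (trans ends (sym ends′)))
      where open Reduction (geodesic u v)

    geodesic-Walk : ∀ u v → Walk G u v (d u v)
    geodesic-Walk u v = subst (λ z → Walk G u z (d u v)) ends (NB⇒Walk path nb-path)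
      where open Reduction (geodesic u v)

  Walk-++ : ∀ {u v w m n} → Walk G u v m → Walk G v w n → Walk G u w (m + n)
  Walk-++ here q = q
  Walk-++ (step u~ p) q = step u~ (Walk-++ p q)

  Walk⇒parity : ∀ {u v n} → Walk G u v n → Σ ℕ λ k → d u v + 2 * k ≡ n
  Walk⇒parity w with reduce w
  ... | reduction xs p ends k len = k , trans (cong (_+ 2 * k) (NB⇒d≡length xs p ends)) len

  d-minimal : ∀ {u v n} → Walk G u v n → d u v ≤ n
  d-minimal w with Walk⇒parity w
  ... | k , len = ≤-trans (m≤m+n _ (2 * k)) (≤-reflexive len)

  d-Dist : ∀ u v → Dist G u v (d u v)
  d-Dist u v = geodesic-Walk u v , λ _ → d-minimal

  Dist⇒≡d : ∀ {u v n} → Dist G u v n → n ≡ d u v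
  Dist⇒≡d (w , minimal) = ≤-antisym (minimal _ (geodesic-Walk _ _)) (d-minimal w)

  d-refl : ∀ u → d u u ≡ 0
  d-refl u = NB⇒d≡length [] one refl

  d≡0⇒≡ : ∀ {u v} → d u v ≡ 0 → u ≡ v
  d≡0⇒≡ {u} {v} d≡0 with geodesic u v | NB⇒d≡length {u} {v}
  ... | reduction [] _ ends _ _ | _ = ends
  ... | reduction (y ∷ ys) p ends _ _ | d≡ = ⊥-elim (0≢1+n (trans (sym d≡0) (d≡ (y ∷ ys) p ends)))

  ≢⇒0<d : ∀ {u v} → u ≢ v → 0 < d u v
  ≢⇒0<d {u} {v} u≢v with d u v in eq
  ... | zero = ⊥-elim (u≢v (d≡0⇒≡ eq))
  ... | suc _ = s≤s z≤n

  d-sym : ∀ u v → d u v ≡ d v u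
  d-sym u v with NB-join u path [] nb-path one tt
    where open Reduction (geodesic u v)
  ... | t , p , ends′ , len = begin
      d u v              ≡⟨ NB⇒d≡length path nb-path ends ⟩
      length path        ≡⟨ sym (+-identityʳ _) ⟩
      length path + 0    ≡⟨ sym len ⟩
      length t           ≡⟨ sym (NB⇒d≡length t (subst (λ z → NonBacktracking (z ∷ t)) ends p)
                                  (trans (cong (λ z → endpoint z t) (sym ends)) ends′)) ⟩
      d v u              ∎
    where
      open Reduction (geodesic u v)
      open ≡-Reasoning

  d-triangle : ∀ u v w → d u w ≤ d u v + d v w
  d-triangle u v w = d-minimal (Walk-++ (geodesic-Walk u v) (geodesic-Walk v w))

  d-adjacent : ∀ {u v} → v ∈ nb u → d u v ≡ 1
  d-adjacent u~v = NB⇒d≡length (_ ∷ []) (two u~v) refl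

  d-parity : ∀ u v x → Σ ℕ λ k → d u x + 2 * k ≡ d u v + d v x
  d-parity u v x = Walk⇒parity (Walk-++ (geodesic-Walk u v) (geodesic-Walk v x))

  -- Branches

  -- The first vertex after v on the geodesic from v to z (v itself when z = v).
  opaque
    towards : V → V → V
    towards v z with Reduction.path (geodesic v z)
    ... | [] = v
    ... | f ∷ _ = f

    towards-spec : ∀ {v z} → z ≢ v → towards v z ∈ nb v × suc (d (towards v z) z) ≡ d v z
    towards-spec {v} {z} z≢v with geodesic v z | NB⇒d≡length {v} {z}
    ... | reduction [] _ ends _ _ | _ = ⊥-elim (z≢v (sym ends))
    ... | reduction (f ∷ ys) p ends _ _ | d≡ =
      NB-adjacent p , sym (trans (d≡ (f ∷ ys) p ends) (cong suc (sym (NB⇒d≡length ys (NB-tail p) ends))))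

  towards-adjacent : ∀ {v z} → z ≢ v → towards v z ∈ nb v
  towards-adjacent = proj₁ ∘ towards-spec

  towards-closer : ∀ {v z} → z ≢ v → suc (d (towards v z) z) ≡ d v z
  towards-closer = proj₂ ∘ towards-spec

  -- For a neighbour a of c, the vertices x with Beyond c a x form the component of T - c containing a.
  Beyond : V → V → V → Set
  Beyond c a x = d a x < d c x

  Beyond? : ∀ c a x → Dec (Beyond c a x)
  Beyond? c a x = d a x <? d c x

  towards-Beyond : ∀ {v z} → z ≢ v → Beyond v (towards v z) z
  towards-Beyond z≢v = ≤-reflexive (towards-closer z≢v)

  Beyond⇒≢ : ∀ {c a x} → Beyond c a x → x ≢ c
  Beyond⇒≢ {c} {a} lt refl = n≮0 (subst (d a c <_) (d-refl c) lt)

  Beyond-self : ∀ {v w} → w ∈ nb v → Beyond v w w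
  Beyond-self {v} {w} v~w = subst₂ _<_ (sym (d-refl w)) (sym (d-adjacent v~w)) (s≤s z≤n)

  Beyond⇒geodesic : ∀ {c a x} → a ∈ nb c → Beyond c a x →
                    Σ (List V) λ ys → NonBacktracking (c ∷ a ∷ ys) × endpoint a ys ≡ x
  Beyond⇒geodesic {c} {a} {x} c~a lt with geodesic c x | NB⇒d≡length {c} {x}
  ... | reduction [] p ends _ _ | d≡ = ⊥-elim (n≮0 (subst (d a x <_) (d≡ [] p ends) lt))
  ... | reduction (f ∷ ys) p ends _ _ | d≡ with f ≟ a
  ...   | yes refl = ys , p , ends
  ...   | no f≢a = ⊥-elim (<-irrefl refl (<-trans (n<1+n _) (subst₂ _<_ dax≡ (d≡ (f ∷ ys) p ends) lt)))
    where
      dax≡ : d a x ≡ length (c ∷ f ∷ ys)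
      dax≡ = NB⇒d≡length (c ∷ f ∷ ys) (more (nb-sym a c c~a) (f≢a ∘ sym) p) ends

  Beyond⇒closer : ∀ {c a x} → a ∈ nb c → Beyond c a x → suc (d a x) ≡ d c x
  Beyond⇒closer c~a lt with Beyond⇒geodesic c~a lt
  ... | ys , p , ends = trans (cong suc (NB⇒d≡length ys (NB-tail p) ends)) (sym (NB⇒d≡length (_ ∷ ys) p ends))

  Beyond-unique : ∀ {c a b x} → a ∈ nb c → b ∈ nb c → Beyond c a x → Beyond c b x → a ≡ b
  Beyond-unique c~a c~b lt₁ lt₂ with Beyond⇒geodesic c~a lt₁ | Beyond⇒geodesic c~b lt₂
  ... | ys , p , e | zs , q , e′ with NB-path-unique (_ ∷ ys) (_ ∷ zs) p q (trans e (sym e′))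
  ...   | refl = refl

  towards-Beyond⁻ : ∀ {c a x} → a ∈ nb c → Beyond c a x → towards c x ≡ a
  towards-Beyond⁻ c~a lt = Beyond-unique (towards-adjacent (Beyond⇒≢ lt)) c~a (towards-Beyond (Beyond⇒≢ lt)) lt

  d-across : ∀ {c a b x y} → a ∈ nb c → b ∈ nb c → a ≢ b → Beyond c a x → Beyond c b y → d x y ≡ d c x + d c y
  d-across {c} c~a c~b a≢b ltx lty with Beyond⇒geodesic c~a ltx | Beyond⇒geodesic c~b lty
  ... | ys , p , ex | zs , q , ey with NB-join c (_ ∷ ys) (_ ∷ zs) p q a≢b
  ...   | t , r , ends , len = begin
      d _ _                         ≡⟨ NB⇒d≡length t (subst (λ z → NonBacktracking (z ∷ t)) ex r)
                                         (trans (cong (λ z → endpoint z t) (sym ex)) (trans ends ey)) ⟩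
      length t                      ≡⟨ len ⟩
      suc (length ys) + suc (length zs) ≡⟨ sym (cong₂ _+_ (NB⇒d≡length (_ ∷ ys) p ex) (NB⇒d≡length (_ ∷ zs) q ey)) ⟩
      d c _ + d c _                 ∎
    where open ≡-Reasoning

  Beyond-closed : ∀ {v a z z'} → a ∈ nb v → Beyond v a z → z' ∈ nb z → z' ≢ v → Beyond v a z'
  Beyond-closed {v} {a} {z} {z'} v~a ltz z~z' z'≢v with towards v z' ≟ a
  ... | yes e = subst (λ b → Beyond v b z') e (towards-Beyond z'≢v)
  ... | no t≢a = ⊥-elim (1+n≰n (subst (2 ≤_) d≡1 (+-mono-≤ (≤-trans (s≤s z≤n) ltz) (≢⇒0<d (z'≢v ∘ sym)))))
    where
      d≡1 : d v z + d v z' ≡ 1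
      d≡1 = trans (sym (d-across v~a (towards-adjacent z'≢v) (t≢a ∘ sym) ltz (towards-Beyond z'≢v))) (d-adjacent z~z')

  ReachAvoid⇒≢ : ∀ {v w u} → ReachAvoid G v w u → u ≢ v
  ReachAvoid⇒≢ (here u≢v) = u≢v
  ReachAvoid⇒≢ (step _ _ r) = ReachAvoid⇒≢ r

  ReachAvoid⇒Beyond : ∀ {v w u} → w ∈ nb v → ReachAvoid G v w u → Beyond v w u
  ReachAvoid⇒Beyond {v} {w} v~w = go (Beyond-self v~w)
    where
      start≢ : ∀ {z u} → ReachAvoid G v z u → z ≢ v
      start≢ (here z≢v) = z≢v
      start≢ (step z≢v _ _) = z≢v
      go : ∀ {z u} → Beyond v w z → ReachAvoid G v z u → Beyond v w u
      go ltz (here _) = ltz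
      go ltz (step _ z~z' r) = go (Beyond-closed v~w ltz z~z' (start≢ r)) r

  towards-avoids-root : ∀ {v w z u} → w ∈ nb v → Beyond v w z → Beyond v w u → u ≢ z → towards z u ≢ v
  towards-avoids-root {v} {w} {z} {u} v~w ltz ltu u≢z t≡v = 1+n≰n (≤-trans (n≤1+n _) (≤-reflexive loop))
    where
      z~v : v ∈ nb z
      z~v = subst (_∈ nb z) t≡v (towards-adjacent u≢z)
      z≡w : z ≡ w
      z≡w = sym (d≡0⇒≡ (suc-injective (trans (Beyond⇒closer v~w ltz) (trans (d-sym v z) (d-adjacent z~v)))))
      loop : suc (suc (d w u)) ≡ d w u
      loop = begin
        suc (suc (d w u)) ≡⟨ cong suc (Beyond⇒closer v~w ltu) ⟩
        suc (d v u)       ≡⟨ cong (λ t → suc (d t u)) (sym t≡v) ⟩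
        suc (d (towards z u) u) ≡⟨ towards-closer u≢z ⟩
        d z u             ≡⟨ cong (λ t → d t u) z≡w ⟩
        d w u             ∎
        where open ≡-Reasoning

  Beyond⇒ReachAvoid : ∀ {v w u} → w ∈ nb v → Beyond v w u → ReachAvoid G v w u
  Beyond⇒ReachAvoid {v} {w} {u} v~w ltu = go _ w refl (Beyond-self v~w)
    where
      go : ∀ n z → d z u ≡ n → Beyond v w z → ReachAvoid G v z u
      go zero z d≡0 ltz = subst (ReachAvoid G v z) (d≡0⇒≡ d≡0) (here (Beyond⇒≢ ltz))
      go (suc n) z d≡ ltz = step (Beyond⇒≢ ltz) (towards-adjacent u≢z)
                                 (go n (towards z u) (suc-injective (trans (towards-closer u≢z) d≡))
                                     (Beyond-closed v~w ltz (towards-adjacent u≢z) (towards-avoids-root v~w ltz ltu u≢z)))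
        where
          u≢z : u ≢ z
          u≢z refl = 0≢1+n (trans (sym (d-refl u)) d≡)

  d-through : ∀ {v w z u} → w ∈ nb v → Beyond v w u → z ≢ v → ¬ Beyond v w z → d z u ≡ d v z + d v u
  d-through v~w ltu z≢v z∉ =
    d-across (towards-adjacent z≢v) v~w (λ t≡w → z∉ (subst (λ t → Beyond _ t _) t≡w (towards-Beyond z≢v)))
             (towards-Beyond z≢v) ltu

  Beyond-nested : ∀ {c a u w x} → a ∈ nb c → Beyond c a u → w ∈ nb u → ¬ Beyond u w c → Beyond u w x → Beyond c a x
  Beyond-nested {c} {a} {u} {w} {x} c~a ltu u~w c∉ ltx = begin-strict
      d a x          ≤⟨ d-triangle a u x ⟩
      d a u + d u x  <⟨ +-monoˡ-< (d u x) (≤-reflexive (Beyond⇒closer c~a ltu)) ⟩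
      d c u + d u x  ≡⟨ cong (_+ d u x) (d-sym c u) ⟩
      d u c + d u x  ≡⟨ sym (d-through u~w ltx (Beyond⇒≢ ltu ∘ sym) c∉) ⟩
      d c x          ∎
    where open ≤-Reasoning

  geodesic-point : ∀ u v j → j ≤ d u v → Σ V λ c → d u c ≡ j × d c v + j ≡ d u v
  geodesic-point u v zero _ = u , d-refl u , +-identityʳ _
  geodesic-point u v (suc j) j<d with geodesic-point u v j (≤-trans (n≤1+n j) j<d)
  ... | c , duc , dcv = f , ≤-antisym d≤ d≥ , df
    where
      v≢c : v ≢ c
      v≢c refl = 1+n≰n (subst (suc j ≤_) (sym (trans (cong (_+ j) (sym (d-refl v))) dcv)) j<d)
      f = towards c v
      df : d f v + suc j ≡ d u v
      df = trans (+-suc (d f v) j) (trans (cong (_+ j) (towards-closer v≢c)) dcv)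
      d≤ : d u f ≤ suc j
      d≤ = ≤-trans (d-triangle u c f) (≤-reflexive (trans (cong₂ _+_ duc (d-adjacent (towards-adjacent v≢c))) (+-comm j 1)))
      d≥ : suc j ≤ d u f
      d≥ = +-cancelʳ-≤ (d f v) _ _ (≤-trans (≤-reflexive (trans (+-comm (suc j) (d f v)) df)) (d-triangle u f v))

  midpoint-split : ∀ {u v h} → 0 < h → d u v ≡ h + h →
                   Σ V λ c → d c u ≡ d c v × u ≢ c × v ≢ c × towards c u ≢ towards c v
  midpoint-split {u} {v} {h} 0<h d≡ with geodesic-point u v h (≤-trans (m≤m+n h h) (≤-reflexive (sym d≡)))
  ... | c , duc , dcv+h = c , trans dcu (sym dcv) , u≢c , v≢c , a≢b
    where
      dcv : d c v ≡ h
      dcv = +-cancelʳ-≡ h _ _ (trans dcv+h d≡)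
      dcu : d c u ≡ h
      dcu = trans (d-sym c u) duc
      u≢c : u ≢ c
      u≢c refl = <-irrefl (trans (sym (d-refl u)) duc) 0<h
      v≢c : v ≢ c
      v≢c refl = <-irrefl (trans (sym (d-refl v)) dcv) 0<h
      a = towards c u
      a≢b : a ≢ towards c v
      a≢b a≡b = 1+n≰n (≤-trans (n≤1+n _) (begin
          suc (suc (d u v))         ≤⟨ s≤s (s≤s (d-triangle u a v)) ⟩
          suc (suc (d u a + d a v)) ≡⟨ cong (λ t → suc (suc (t + d a v))) (d-sym u a) ⟩
          suc (suc (d a u + d a v)) ≡⟨ cong suc (sym (+-suc (d a u) (d a v))) ⟩
          suc (d a u) + suc (d a v) ≡⟨ cong₂ _+_ (trans (towards-closer u≢c) dcu)
                                         (trans (cong (λ t → suc (d t v)) a≡b) (trans (towards-closer v≢c) dcv)) ⟩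
          h + h                     ≡⟨ sym d≡ ⟩
          d u v                     ∎))
        where open ≤-Reasoning

  nearer-in-branch : ∀ {c a b y₁ y₂ x} → a ∈ nb c → b ∈ nb c → a ≢ b → Beyond c a y₁ → Beyond c b y₂ →
                     d c y₁ ≡ d c y₂ → Beyond c a x → d y₁ x < d y₂ x
  nearer-in-branch {c} {a} {b} {y₁} {y₂} {x} c~a c~b a≢b lt₁ lt₂ e ltx = begin-strict
      d y₁ x               ≤⟨ d-triangle y₁ a x ⟩
      d y₁ a + d a x       ≡⟨ cong (_+ d a x) (d-sym y₁ a) ⟩
      d a y₁ + d a x       <⟨ +-mono-≤-< (n≤1+n _) (n<1+n _) ⟩
      suc (d a y₁) + suc (d a x) ≡⟨ cong₂ _+_ (Beyond⇒closer c~a lt₁) (Beyond⇒closer c~a ltx) ⟩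
      d c y₁ + d c x       ≡⟨ cong (_+ d c x) e ⟩
      d c y₂ + d c x       ≡⟨ sym (d-across c~b c~a (a≢b ∘ sym) lt₂ ltx) ⟩
      d y₂ x               ∎
    where open ≤-Reasoning

  -- Resolving sets

  MeetsBranch : List V → V → V → Set
  MeetsBranch S c a = ∃ λ x → x ∈ S × Beyond c a x

  MeetsBranch? : ∀ S c a → Dec (MeetsBranch S c a)
  MeetsBranch? S c a with any? (Beyond? c a) S
  ... | yes hit = yes (find hit)
  ... | no miss = no (λ (x , x∈ , ltx) → miss (lose x∈ ltx))

  BranchResolving : List V → Set
  BranchResolving S = ∀ c a b → a ∈ nb c → b ∈ nb c → a ≢ b → MeetsBranch S c a ⊎ MeetsBranch S c b

  resolves : ∀ {x u v} → d u x ≢ d v x → Resolves G x u v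
  resolves d≢ m n du dv m≡n = d≢ (trans (sym (Dist⇒≡d du)) (trans m≡n (Dist⇒≡d dv)))

  -- Neighbours a, b of c must be resolved by some x ∈ S; if x is in neither branch, d a x = 1 + d c x = d b x.
  Resolving⇒BranchResolving : ∀ {S} → Resolving G S → BranchResolving S
  Resolving⇒BranchResolving {S} res c a b c~a c~b a≢b with res a b a≢b
  ... | x , x∈ , x-res with x ≟ c
  ...   | yes refl = ⊥-elim (x-res _ _ (d-Dist a x) (d-Dist b x) (trans (d-sym a x)
                       (trans (d-adjacent c~a) (sym (trans (d-sym b x) (d-adjacent c~b))))))
  ...   | no x≢c with towards c x ≟ a | towards c x ≟ b
  ...     | yes t≡a | _ = inj₁ (x , x∈ , subst (λ t → Beyond c t x) t≡a (towards-Beyond x≢c))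
  ...     | no _ | yes t≡b = inj₂ (x , x∈ , subst (λ t → Beyond c t x) t≡b (towards-Beyond x≢c))
  ...     | no t≢a | no t≢b = ⊥-elim (x-res _ _ (d-Dist a x) (d-Dist b x) (begin
      d a x           ≡⟨ d-across c~a (towards-adjacent x≢c) (t≢a ∘ sym) (Beyond-self c~a) (towards-Beyond x≢c) ⟩
      d c a + d c x   ≡⟨ cong (_+ d c x) (trans (d-adjacent c~a) (sym (d-adjacent c~b))) ⟩
      d c b + d c x   ≡⟨ sym (d-across c~b (towards-adjacent x≢c) (t≢b ∘ sym) (Beyond-self c~b) (towards-Beyond x≢c)) ⟩
      d b x           ∎))
    where open ≡-Reasoning

  odd-distance-resolved : ∀ {u v h} x → d u v ≡ suc (h + h) → d u x ≢ d v x
  odd-distance-resolved {u} {v} {h} x d≡ e with d-parity u v x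
  ... | k , eq = even≢odd k h (trans (+-cancelˡ-≡ (d v x) _ _ (begin
      d v x + 2 * k  ≡⟨ cong (_+ 2 * k) (sym e) ⟩
      d u x + 2 * k  ≡⟨ eq ⟩
      d u v + d v x  ≡⟨ +-comm (d u v) (d v x) ⟩
      d v x + d u v  ∎)) (trans d≡ (cong (λ t → suc (h + t)) (sym (+-identityʳ h)))))
    where open ≡-Reasoning

  -- u and v lie in different branches at their midpoint; a vertex of S in either is nearer to one of them.
  even-distance-resolved : ∀ {S u v h} → BranchResolving S → 0 < h → d u v ≡ h + h →
                           ∃ λ x → x ∈ S × d u x ≢ d v x
  even-distance-resolved res 0<h d≡ with midpoint-split 0<h d≡
  ... | c , dcu≡dcv , u≢c , v≢c , a≢b with res c _ _ (towards-adjacent u≢c) (towards-adjacent v≢c) a≢b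
  ...   | inj₁ (x , x∈ , ltx) = x , x∈ , λ e → <-irrefl e
            (nearer-in-branch (towards-adjacent u≢c) (towards-adjacent v≢c) a≢b
               (towards-Beyond u≢c) (towards-Beyond v≢c) dcu≡dcv ltx)
  ...   | inj₂ (x , x∈ , ltx) = x , x∈ , λ e → <-irrefl (sym e)
            (nearer-in-branch (towards-adjacent v≢c) (towards-adjacent u≢c) (a≢b ∘ sym)
               (towards-Beyond v≢c) (towards-Beyond u≢c) (sym dcu≡dcv) ltx)

  BranchResolving⇒Resolving : ∀ {S x₀} → x₀ ∈ S → BranchResolving S → Resolving G S
  BranchResolving⇒Resolving {S} {x₀} x₀∈ res u v u≢v = [ even , odd ] (even-or-odd (d u v))
    where
      odd : (Σ ℕ λ h → d u v ≡ suc (h + h)) → ∃ λ x → x ∈ S × Resolves G x u v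
      odd (h , d≡) = x₀ , x₀∈ , resolves (odd-distance-resolved {h = h} x₀ d≡)
      half-pos : ∀ h → 0 < h + h → 0 < h
      half-pos (suc _) _ = s≤s z≤n
      even : (Σ ℕ λ h → d u v ≡ h + h) → ∃ λ x → x ∈ S × Resolves G x u v
      even (h , d≡) with even-distance-resolved res (half-pos h (subst (0 <_) d≡ (≢⇒0<d u≢v))) d≡
      ... | x , x∈ , d≢ = x , x∈ , resolves d≢

  -- Major vertices and branch paths

  ball : V → ℕ → List V
  ball x zero = x ∷ []
  ball x (suc r) = ball x r ++ concatMap nb (ball x r)

  ball-complete : ∀ x r {z} → d x z ≤ r → z ∈ ball x r
  ball-complete x zero d≤0 = here (sym (d≡0⇒≡ (n≤0⇒n≡0 d≤0)))
  ball-complete x (suc r) {z} d≤ with d x z ≤? r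
  ... | yes d≤r = ∈-++⁺ˡ (ball-complete x r d≤r)
  ... | no d≰r = ∈-++⁺ʳ (ball x r) (∈-concatMap⁺ nb (lose (ball-complete x r df≤r) (nb-sym f z (towards-adjacent x≢z))))
    where
      x≢z : x ≢ z
      x≢z refl = d≰r (subst (_≤ r) (sym (d-refl x)) z≤n)
      f = towards z x
      df≤r : d x f ≤ r
      df≤r = ≤-pred (≤-trans (≤-reflexive (trans (cong suc (d-sym x f)) (trans (towards-closer x≢z) (d-sym z x)))) d≤)

  -- Contains every vertex on a geodesic between two vertices of R.
  hull : List V → List V
  hull R = concatMap (λ x → concatMap (λ x′ → ball x (d x x′)) R) R

  hull-complete : ∀ {R x x′ y} → x ∈ R → x′ ∈ R → d x y ≤ d x x′ → y ∈ hull R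
  hull-complete {R} x∈ x′∈ d≤ = ∈-concatMap⁺ _ (lose x∈ (∈-concatMap⁺ _ (lose x′∈ (ball-complete _ _ d≤))))

  Major : V → Set
  Major v = 3 ≤ deg G v

  Major? : Decidable Major
  Major? v = 3 ≤? deg G v

  module FiniteMajors (R : List V) (R-res : BranchResolving R) where

    private
      between : ∀ {y p q x x′} → p ∈ nb y → q ∈ nb y → p ≢ q → x ∈ R → x′ ∈ R →
                Beyond y p x → Beyond y q x′ → y ∈ hull R
      between {y} {x = x} {x′} y~p y~q p≢q x∈ x′∈ ltx ltx′ = hull-complete x∈ x′∈ (begin
        d x y            ≡⟨ d-sym x y ⟩
        d y x            ≤⟨ m≤m+n (d y x) (d y x′) ⟩
        d y x + d y x′   ≡⟨ sym (d-across y~p y~q p≢q ltx ltx′) ⟩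
        d x x′           ∎)
        where open ≤-Reasoning

      from-one-met : ∀ {y p q r} → p ∈ nb y → q ∈ nb y → r ∈ nb y → p ≢ q → p ≢ r → q ≢ r →
                     MeetsBranch R y p → y ∈ hull R
      from-one-met y~p y~q y~r p≢q p≢r q≢r (x , x∈ , ltx) with R-res _ _ _ y~q y~r q≢r
      ... | inj₁ (x′ , x′∈ , ltx′) = between y~p y~q p≢q x∈ x′∈ ltx ltx′
      ... | inj₂ (x′ , x′∈ , ltx′) = between y~p y~r p≢r x∈ x′∈ ltx ltx′

    -- R meets two of any three branches at a major vertex, which therefore lies between them.
    major∈hull : ∀ {y} → Major y → y ∈ hull R
    major∈hull {y} major with three-distinct (nb-unique y) major
    ... | a , b , c , y~a , y~b , y~c , a≢b , a≢c , b≢c =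
      [ from-one-met y~a y~b y~c a≢b a≢c b≢c , from-one-met y~b y~a y~c (a≢b ∘ sym) b≢c a≢c ] (R-res y a b y~a y~b a≢b)

    majors : List V
    majors = deduplicate _≟_ (filter Major? (hull R))

    majors-unique : Unique majors
    majors-unique = deduplicate-! _≟_ (filter Major? (hull R))

    majors-complete : ∀ {y} → Major y → y ∈ majors
    majors-complete major = ∈-deduplicate⁺ _≟_ (∈-filter⁺ Major? (major∈hull major) major)

    majors-sound : ∀ {y} → y ∈ majors → Major y
    majors-sound y∈ = proj₂ (∈-filter⁻ Major? {xs = hull R} (∈-deduplicate⁻ _≟_ (filter Major? (hull R)) y∈))

    Leg : V → V → Set
    Leg v w = w ∈ nb v × BranchPath G v w

    Leg⇒no-major : ∀ {v w z} → Leg v w → Major z → ¬ Beyond v w z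
    Leg⇒no-major (v~w , path) major ltz = 1+n≰n (≤-trans major (path _ (Beyond⇒ReachAvoid v~w ltz)))

    path-or-major : ∀ {v w} → w ∈ nb v → BranchPath G v w ⊎ (∃ λ y → Major y × Beyond v w y)
    path-or-major {v} {w} v~w with any? (Beyond? v w) majors
    ... | yes hit = let (y , y∈ , lty) = find hit in inj₂ (y , majors-sound y∈ , lty)
    ... | no miss = inj₁ deg≤2
      where
        deg≤2 : BranchPath G v w
        deg≤2 u reach with Major? u
        ... | yes major = ⊥-elim (miss (lose (majors-complete major) (ReachAvoid⇒Beyond v~w reach)))
        ... | no ¬major = ≤-pred (≰⇒> ¬major)

    Leg? : ∀ v → Decidable (Leg v)
    Leg? v w with w ∈? nb v
    ... | no w∉ = no (w∉ ∘ proj₁)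
    ... | yes v~w with path-or-major v~w
    ...   | inj₁ path = yes (v~w , path)
    ...   | inj₂ (y , major , lty) = no (λ leg → Leg⇒no-major leg major lty)

    legs : V → ℕ
    legs v = count (Leg? v) (nb v)

    legs-NumBranchPaths : ∀ v → NumBranchPaths G v (legs v)
    legs-NumBranchPaths v = Count-cong {Q = BranchPath G v} (λ _ → proj₂) (λ v~w path → v~w , path) (count-Count (Leg? v) (nb v))

    NumBranchPaths⇒≡legs : ∀ {v k} → NumBranchPaths G v k → k ≡ legs v
    NumBranchPaths⇒≡legs {v} c = Count⇒≡count (Leg? v) (Count-cong {Q = Leg v} (λ v~w path → v~w , path) (λ _ → proj₂) c)

    OnBranchPath⇒Leg : ∀ {v u} → OnBranchPath G v u → u ≢ v × Leg v (towards v u)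
    OnBranchPath⇒Leg (w , v~w , path , reach) = ReachAvoid⇒≢ reach ,
      subst (Leg _) (sym (towards-Beyond⁻ v~w (ReachAvoid⇒Beyond v~w reach))) (v~w , path)

    Leg⇒OnBranchPath : ∀ {v w u} → Leg v w → Beyond v w u → OnBranchPath G v u
    Leg⇒OnBranchPath (v~w , path) ltu = _ , v~w , path , Beyond⇒ReachAvoid v~w ltu

    OnBranchPath? : ∀ v → Decidable (OnBranchPath G v)
    OnBranchPath? v u = Dec.map′ (λ (u≢v , leg) → Leg⇒OnBranchPath leg (towards-Beyond u≢v)) OnBranchPath⇒Leg
                                 (¬? (u ≟ v) ×-dec Leg? v (towards v u))

    -- Legs at two different major vertices are disjoint: a vertex on both would put each major
    -- vertex on the other's leg.
    legs-disjoint : ∀ {v v′ u} → Major v → Major v′ → OnBranchPath G v u → OnBranchPath G v′ u → v ≡ v′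
    legs-disjoint {v} {v′} {u} major major′ (w , v~w , path , reach) (w′ , v′~w′ , path′ , reach′) with v ≟ v′
    ... | yes v≡v′ = v≡v′
    ... | no v≢v′ = ⊥-elim (Leg⇒no-major leg′ major (subst₂ _<_ (d-sym v w′) (d-sym v v′) d<d))
      where
        leg = (v~w , path)
        leg′ = (v′~w′ , path′)
        ltu = ReachAvoid⇒Beyond v~w reach
        v′∉ : ¬ Beyond v w v′
        v′∉ = Leg⇒no-major leg major′
        w′≢v : w′ ≢ v
        w′≢v refl = Leg⇒no-major leg′ major (Beyond-self v′~w′)
        w′∉ : ¬ Beyond v w w′
        w′∉ ltw′ = v′∉ (Beyond-closed v~w ltw′ (nb-sym w′ v′ v′~w′) (v≢v′ ∘ sym))
        d<d : suc (d v w′) ≤ d v v′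
        d<d = ≤-reflexive (+-cancelʳ-≡ (d v u) _ _ (begin
          suc (d v w′) + d v u ≡⟨ cong suc (sym (d-through v~w ltu w′≢v w′∉)) ⟩
          suc (d w′ u)         ≡⟨ Beyond⇒closer v′~w′ (ReachAvoid⇒Beyond v′~w′ reach′) ⟩
          d v′ u               ≡⟨ d-through v~w ltu (v≢v′ ∘ sym) v′∉ ⟩
          d v v′ + d v u       ∎))
          where open ≡-Reasoning

    two-legs⇒Major : ∀ {y₀ v} → Major y₀ → 2 ≤ legs v → Major v
    two-legs⇒Major {y₀} {v} major₀ 2≤legs with y₀ ≟ v
    ... | yes refl = major₀
    ... | no y₀≢v with 2≤count⇒distinct (Leg? v) (nb-unique v) 2≤legs
    ...   | w₁ , w₂ , w₁∈ , w₂∈ , leg₁ , leg₂ , w₁≢w₂ =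
      Unique⇒length≤ _≟_ ((t≢ leg₁ ∷ t≢ leg₂ ∷ []) ∷ (w₁≢w₂ ∷ []) ∷ [] ∷ [])
        λ { (here refl) → towards-adjacent y₀≢v ; (there (here refl)) → w₁∈ ; (there (there (here refl))) → w₂∈ }
      where
        t≢ : ∀ {w} → Leg v w → towards v y₀ ≢ w
        t≢ leg refl = Leg⇒no-major leg major₀ (towards-Beyond y₀≢v)

    LegResolving : List V → V → Set
    LegResolving S v = ∀ {w₁ w₂} → Leg v w₁ → Leg v w₂ → w₁ ≢ w₂ → MeetsBranch S v w₁ ⊎ MeetsBranch S v w₂

    BranchResolving⇒LegResolving : ∀ {S} → BranchResolving S → ∀ v → LegResolving S v
    BranchResolving⇒LegResolving res v leg₁ leg₂ = res v _ _ (proj₁ leg₁) (proj₁ leg₂)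

    legList : V → List V
    legList v = filter (Leg? v) (nb v)

    legList-Leg : ∀ {v w} → w ∈ legList v → Leg v w
    legList-Leg {v} w∈ = proj₂ (∈-filter⁻ (Leg? v) {xs = nb v} w∈)

    legList-unique : ∀ v → Unique (legList v)
    legList-unique v = Unique.filter⁺ (Leg? v) (nb-unique v)

    -- The leg at v through each vertex of S lying on one, with repetitions.
    hitLegs : List V → V → List V
    hitLegs S v = map (towards v) (filter (OnBranchPath? v) S)

    hitLegs-length : ∀ S v → length (hitLegs S v) ≡ count (OnBranchPath? v) S
    hitLegs-length S v = length-map (towards v) (filter (OnBranchPath? v) S)

    hitLegs-Leg : ∀ {S v w} → w ∈ hitLegs S v → Leg v w × MeetsBranch S v w
    hitLegs-Leg {S} {v} w∈ with ∈-map⁻ (towards v) w∈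
    ... | u , u∈ , refl with ∈-filter⁻ (OnBranchPath? v) {xs = S} u∈
    ...   | u∈S , on = let (u≢v , leg) = OnBranchPath⇒Leg on in leg , u , u∈S , towards-Beyond u≢v

    metLegs⊆hitLegs : ∀ S v → filter (MeetsBranch? S v) (legList v) ⊆ hitLegs S v
    metLegs⊆hitLegs S v w∈ with ∈-filter⁻ (MeetsBranch? S v) {xs = legList v} w∈
    ... | w∈legs , (x , x∈ , ltx) = let leg = legList-Leg {v} w∈legs in
      subst (_∈ hitLegs S v) (towards-Beyond⁻ (proj₁ leg) ltx)
            (∈-map⁺ (towards v) (∈-filter⁺ (OnBranchPath? v) x∈ (Leg⇒OnBranchPath leg ltx)))

    -- At most one leg at v is missed by S, so S meets at least legs v ∸ 1 of them.
    LegResolving⇒met : ∀ {S v} → LegResolving S v → legs v ∸ 1 ≤ count (MeetsBranch? S v) (legList v)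
    LegResolving⇒met {S} {v} leg-res = begin
        legs v ∸ 1                ≤⟨ ∸-monoʳ-≤ (legs v) missed≤1 ⟩
        legs v ∸ missed           ≡⟨ cong (_∸ missed) (sym (count-∁ (MeetsBranch? S v) (legList v))) ⟩
        met + missed ∸ missed     ≡⟨ m+n∸n≡m met missed ⟩
        met                       ∎
      where
        open ≤-Reasoning
        met = count (MeetsBranch? S v) (legList v)
        missed = count (∁? (MeetsBranch? S v)) (legList v)
        missed≤1 : missed ≤ 1
        missed≤1 = count≤1 (∁? (MeetsBranch? S v)) (legList-unique v) same
          where
            same : ∀ {a b} → a ∈ legList v → b ∈ legList v → ¬ MeetsBranch S v a → ¬ MeetsBranch S v b → a ≡ b
            same {a} {b} a∈ b∈ ¬a ¬b with a ≟ b
            ... | yes a≡b = a≡b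
            ... | no a≢b = ⊥-elim ([ ¬a , ¬b ] (leg-res (legList-Leg a∈) (legList-Leg b∈) a≢b))

    LegResolving⇒onLegs : ∀ {S v} → LegResolving S v → legs v ∸ 1 ≤ count (OnBranchPath? v) S
    LegResolving⇒onLegs {S} {v} leg-res = begin
        legs v ∸ 1                                       ≤⟨ LegResolving⇒met leg-res ⟩
        count (MeetsBranch? S v) (legList v)             ≤⟨ Unique⇒length≤ _≟_ (Unique.filter⁺ (MeetsBranch? S v) (legList-unique v))
                                                                             (metLegs⊆hitLegs S v) ⟩
        length (hitLegs S v)                             ≡⟨ hitLegs-length S v ⟩
        count (OnBranchPath? v) S                        ∎
      where open ≤-Reasoning

    module _ {S : List V} (leg-res : ∀ v → LegResolving S v) where

      -- At most one branch at u contains c, so a major u has two branches pointing away from c;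
      -- if both were legs, S would meet one of them, inside the branch at c through a.
      away-non-leg : ∀ {c a u} → a ∈ nb c → ¬ MeetsBranch S c a → Beyond c a u → Major u →
                     ∃ λ w → w ∈ nb u × ¬ Beyond u w c × ¬ Leg u w
      away-non-leg {c} {a} {u} c~a avoided ltu major with any? (λ w → ∁? (Beyond? u w) c ×-dec ¬? (Leg? u w)) (nb u)
      ... | yes found = let (w , w∈ , away , ¬leg) = find found in w , w∈ , away , ¬leg
      ... | no none = ⊥-elim (1+n≰n (≤-trans 2≤away (≤-trans away≤away-legs away-legs≤1)))
        where
          Away : Pred V 0ℓ
          Away w = ¬ Beyond u w c
          Away? : Decidable Away
          Away? w = ∁? (Beyond? u w) c
          AwayLeg? : Decidable (λ w → Away w × Leg u w)
          AwayLeg? w = Away? w ×-dec Leg? u w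
          2≤away : 2 ≤ count Away? (nb u)
          2≤away = +-cancelˡ-≤ 1 2 _ (begin
            3                                                   ≤⟨ major ⟩
            deg G u                                             ≡⟨ sym (count-∁ (λ w → Beyond? u w c) (nb u)) ⟩
            count (λ w → Beyond? u w c) (nb u) + count Away? (nb u) ≤⟨ +-monoˡ-≤ _ (count≤1 _ (nb-unique u) Beyond-unique) ⟩
            1 + count Away? (nb u)                                  ∎)
            where open ≤-Reasoning
          away≤away-legs : count Away? (nb u) ≤ count AwayLeg? (nb u)
          away≤away-legs = count-mono _≟_ Away? AwayLeg? (nb-unique u)
            λ {w} w∈ away → away , decidable-stable (Leg? u w) (λ ¬leg → none (lose w∈ (away , ¬leg)))
          away-legs≤1 : count AwayLeg? (nb u) ≤ 1
          away-legs≤1 = count≤1 AwayLeg? (nb-unique u) same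
            where
              inside : ∀ {w} → w ∈ nb u → Away w → MeetsBranch S u w → MeetsBranch S c a
              inside u~w away (x , x∈ , ltx) = x , x∈ , Beyond-nested c~a ltu u~w away ltx
              same : ∀ {w₁ w₂} → w₁ ∈ nb u → w₂ ∈ nb u → Away w₁ × Leg u w₁ → Away w₂ × Leg u w₂ → w₁ ≡ w₂
              same {w₁} {w₂} w₁∈ w₂∈ (away₁ , leg₁) (away₂ , leg₂) with w₁ ≟ w₂
              ... | yes w₁≡w₂ = w₁≡w₂
              ... | no w₁≢w₂ = ⊥-elim (avoided ([ inside w₁∈ away₁ , inside w₂∈ away₂ ] (leg-res u leg₁ leg₂ w₁≢w₂)))

      -- Descend through ever smaller branches, measured by the number of major vertices they contain.
      avoided⇒no-major : ∀ n {c a u} → count (Beyond? c a) majors ≤ n → a ∈ nb c → ¬ MeetsBranch S c a →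
                         Beyond c a u → Major u → ⊥
      avoided⇒no-major zero count≤0 _ _ ltu major =
        n≮0 (≤-trans (filter-some (Beyond? _ _) (lose (majors-complete major) ltu)) count≤0)
      avoided⇒no-major (suc n) {c} {a} {u} count≤ c~a avoided ltu major
        with away-non-leg c~a avoided ltu major
      ... | w , u~w , away , ¬leg with path-or-major u~w
      ...   | inj₁ path = ¬leg (u~w , path)
      ...   | inj₂ (y , major-y , lty) = avoided⇒no-major n smaller u~w avoided′ lty major-y
        where
          nested : ∀ {x} → Beyond u w x → Beyond c a x
          nested = Beyond-nested c~a ltu u~w away
          avoided′ : ¬ MeetsBranch S u w
          avoided′ (x , x∈ , ltx) = avoided (x , x∈ , nested ltx)
          smaller : count (Beyond? u w) majors ≤ n
          smaller = ≤-pred (≤-trans (count-mono-< _≟_ (Beyond? u w) (Beyond? c a) majors-unique (λ _ → nested)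
                                       (majors-complete major) ltu (λ ltu′ → Beyond⇒≢ ltu′ refl)) count≤)

      avoided⇒BranchPath : ∀ {c a} → a ∈ nb c → ¬ MeetsBranch S c a → BranchPath G c a
      avoided⇒BranchPath c~a avoided with path-or-major c~a
      ... | inj₁ path = path
      ... | inj₂ (y , major , lty) = ⊥-elim (avoided⇒no-major _ ≤-refl c~a avoided lty major)

      LegResolving⇒BranchResolving : BranchResolving S
      LegResolving⇒BranchResolving c a b c~a c~b a≢b with MeetsBranch? S c a | MeetsBranch? S c b
      ... | yes meets | _ = inj₁ meets
      ... | no _ | yes meets = inj₂ meets
      ... | no ¬a | no ¬b =
        ⊥-elim ([ ¬a , ¬b ] (leg-res c (c~a , avoided⇒BranchPath c~a ¬a) (c~b , avoided⇒BranchPath c~b ¬b) a≢b))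

    -- The construction and metric bases

    legSum : ℕ
    legSum = sum (map (λ v → legs v ∸ 1) majors)

    majors-BranchSum : BranchSum G majors legSum
    majors-BranchSum = go majors majors-sound
      where
        go : ∀ L → (∀ {v} → v ∈ L → Major v) → BranchSum G L (sum (map (λ v → legs v ∸ 1) L))
        go [] _ = []
        go (v ∷ L) major = big (major (here refl)) (legs-NumBranchPaths v) (go L (major ∘ there))

    OnSomeLeg? : Decidable (λ u → Any (λ v → OnBranchPath G v u) majors)
    OnSomeLeg? u = any? (λ v → OnBranchPath? v u) majors

    legCounts-sum : ∀ S → sum (map (λ v → count (OnBranchPath? v) S) majors) ≡ count OnSomeLeg? S
    legCounts-sum = count-sum OnBranchPath? majors-unique
                      (λ v∈ v′∈ → legs-disjoint (majors-sound v∈) (majors-sound v′∈))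

    legSum≤ : ∀ {S} → BranchResolving S → legSum ≤ length S
    legSum≤ {S} res = begin
      legSum                                                 ≤⟨ sum-map-mono majors (λ _ → LegResolving⇒onLegs (leg-res _)) ⟩
      sum (map (λ v → count (OnBranchPath? v) S) majors)     ≡⟨ legCounts-sum S ⟩
      count OnSomeLeg? S                                     ≤⟨ length-filter OnSomeLeg? S ⟩
      length S                                               ∎
      where
        open ≤-Reasoning
        leg-res : ∀ v → LegResolving S v
        leg-res = BranchResolving⇒LegResolving res

    length≡legSum : ∀ {S} → (∀ {u} → u ∈ S → Any (λ v → OnBranchPath G v u) majors) →
                    (∀ {v} → v ∈ majors → count (OnBranchPath? v) S ≡ legs v ∸ 1) → length S ≡ legSum
    length≡legSum {S} onLeg exact = begin
      length S                                               ≡⟨ cong length (sym (filter-all OnSomeLeg? (All.tabulate onLeg))) ⟩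
      count OnSomeLeg? S                                     ≡⟨ sym (legCounts-sum S) ⟩
      sum (map (λ v → count (OnBranchPath? v) S) majors)     ≡⟨ sum-map-cong majors exact ⟩
      legSum                                                 ∎
      where open ≡-Reasoning

    spareLegs : V → List V
    spareLegs v = drop 1 (legList v)

    spareLegs⊆legList : ∀ {v} → spareLegs v ⊆ legList v
    spareLegs⊆legList {v} with legList v
    ... | _ ∷ _ = there

    spareLegs-OnBranchPath : ∀ {v u} → u ∈ spareLegs v → OnBranchPath G v u
    spareLegs-OnBranchPath u∈ = let leg = legList-Leg (spareLegs⊆legList u∈) in Leg⇒OnBranchPath leg (Beyond-self (proj₁ leg))

    spareLegs-unique : ∀ v → Unique (spareLegs v)
    spareLegs-unique v = Unique.drop⁺ 1 (legList-unique v)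

    spareLegs-length : ∀ v → length (spareLegs v) ≡ legs v ∸ 1
    spareLegs-length v = length-drop 1 (legList v)

    spareLegs⇒2≤legs : ∀ {v u} → u ∈ spareLegs v → 2 ≤ legs v
    spareLegs⇒2≤legs {v} u∈ with legList v
    ... | _ ∷ _ ∷ _ = s≤s (s≤s z≤n)

    -- At each major vertex, every leg but the first contributes its vertex next to v.
    canonical : List V
    canonical = concatMap spareLegs majors

    ∈canonical⁻ : ∀ {u} → u ∈ canonical → ∃ λ v → v ∈ majors × u ∈ spareLegs v
    ∈canonical⁻ u∈ = find (∈-concatMap⁻ spareLegs {xs = majors} u∈)

    ∈canonical⁺ : ∀ {u v} → v ∈ majors → u ∈ spareLegs v → u ∈ canonical
    ∈canonical⁺ v∈ u∈ = ∈-concatMap⁺ spareLegs (lose v∈ u∈)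

    canonical-at : ∀ {u v} → u ∈ canonical → Major v → OnBranchPath G v u → u ∈ spareLegs v
    canonical-at u∈ major on with ∈canonical⁻ u∈
    ... | v′ , v′∈ , u∈′ with legs-disjoint major (majors-sound v′∈) on (spareLegs-OnBranchPath u∈′)
    ...   | refl = u∈′

    canonical-unique : Unique canonical
    canonical-unique = go majors (λ v∈ → v∈) majors-unique
      where
        go : ∀ L → L ⊆ majors → Unique L → Unique (concatMap spareLegs L)
        go [] _ _ = []
        go (v ∷ L) L⊆ (v∉L ∷ !L) = Unique.++⁺ (spareLegs-unique v) (go L (L⊆ ∘ there) !L) disjoint
          where
            disjoint : ∀ {u} → ¬ (u ∈ spareLegs v × u ∈ concatMap spareLegs L)
            disjoint (u∈v , u∈L) with find (∈-concatMap⁻ spareLegs {xs = L} u∈L)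
            ... | v′ , v′∈ , u∈v′ = All.lookup v∉L v′∈
              (legs-disjoint (majors-sound (L⊆ (here refl))) (majors-sound (L⊆ (there v′∈)))
                 (spareLegs-OnBranchPath u∈v) (spareLegs-OnBranchPath u∈v′))

    canonical-count : ∀ {v} → Major v → count (OnBranchPath? v) canonical ≡ legs v ∸ 1
    canonical-count {v} major = trans
      (≤-antisym (Unique⇒length≤ _≟_ (Unique.filter⁺ (OnBranchPath? v) canonical-unique) ⊆spare)
                 (Unique⇒length≤ _≟_ (spareLegs-unique v) spare⊆))
      (spareLegs-length v)
      where
        ⊆spare : filter (OnBranchPath? v) canonical ⊆ spareLegs v
        ⊆spare u∈ = let (u∈c , on) = ∈-filter⁻ (OnBranchPath? v) {xs = canonical} u∈ in canonical-at u∈c major on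
        spare⊆ : spareLegs v ⊆ filter (OnBranchPath? v) canonical
        spare⊆ u∈ = ∈-filter⁺ (OnBranchPath? v) (∈canonical⁺ (majors-complete major) u∈) (spareLegs-OnBranchPath u∈)

    OnDistinctLegs : List V → V → Set
    OnDistinctLegs S v = ∀ u u′ w w′ → u ∈ S → u′ ∈ S → u ≢ u′ → w ∈ nb v → w′ ∈ nb v →
                         BranchPath G v w → BranchPath G v w′ → InBranch G v w u → InBranch G v w′ u′ → w ≢ w′

    hitLegs-unique⇒OnDistinctLegs : ∀ {S v} → Unique (hitLegs S v) → OnDistinctLegs S v
    hitLegs-unique⇒OnDistinctLegs {S} {v} !hits u u′ w w′ u∈ u′∈ u≢u′ v~w v~w′ path path′ reach reach′ w≡w′ =
      u≢u′ (Unique-map⁻ !hits (∈-filter⁺ (OnBranchPath? v) u∈ (w , v~w , path , reach))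
                               (∈-filter⁺ (OnBranchPath? v) u′∈ (w′ , v~w′ , path′ , reach′))
                               (trans (towards-Beyond⁻ v~w (ReachAvoid⇒Beyond v~w reach))
                                 (trans w≡w′ (sym (towards-Beyond⁻ v~w′ (ReachAvoid⇒Beyond v~w′ reach′))))))

    OnDistinctLegs⇒hitLegs-unique : ∀ {S v} → Unique S → OnDistinctLegs S v → Unique (hitLegs S v)
    OnDistinctLegs⇒hitLegs-unique {S} {v} !S distinct = Unique-map (Unique.filter⁺ (OnBranchPath? v) !S) injective
      where
        injective : ∀ {x x′} → x ∈ filter (OnBranchPath? v) S → x′ ∈ filter (OnBranchPath? v) S → x ≢ x′ →
                    towards v x ≢ towards v x′
        injective x∈ x′∈ x≢x′ with ∈-filter⁻ (OnBranchPath? v) {xs = S} x∈ | ∈-filter⁻ (OnBranchPath? v) {xs = S} x′∈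
        ... | x∈S , on | x′∈S , on′ with OnBranchPath⇒Leg on | OnBranchPath⇒Leg on′
        ...   | x≢v , v~t , path | x′≢v , v~t′ , path′ =
          distinct _ _ _ _ x∈S x′∈S x≢x′ v~t v~t′ path path′
                   (Beyond⇒ReachAvoid v~t (towards-Beyond x≢v)) (Beyond⇒ReachAvoid v~t′ (towards-Beyond x′≢v))

    module Characterisation {y₀ : V} (major₀ : Major y₀) where

      BranchResolving⇒nonempty : ∀ {S} → BranchResolving S → ∃ λ x → x ∈ S
      BranchResolving⇒nonempty res with three-distinct (nb-unique y₀) major₀
      ... | a , b , _ , a∈ , b∈ , _ , a≢b , _ =
        [ (λ (x , x∈ , _) → x , x∈) , (λ (x , x∈ , _) → x , x∈) ] (res y₀ a b a∈ b∈ a≢b)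

      -- Two legs at v missed by S, together with the k ∸ 1 distinct legs that S hits, would give k + 1 legs.
      Constructed⇒LegResolving : ∀ {S} → Constructed G S → ∀ v → LegResolving S v
      Constructed⇒LegResolving {S} (!S , at-branching , _) v {w₁} {w₂} leg₁ leg₂ w₁≢w₂
        with MeetsBranch? S v w₁ | MeetsBranch? S v w₂
      ... | yes meets | _ = inj₁ meets
      ... | no _ | yes meets = inj₂ meets
      ... | no ¬meets₁ | no ¬meets₂ = ⊥-elim (1+n≰n (begin
          suc (legs v)                      ≡⟨ cong suc (sym (m+[n∸m]≡n (≤-trans (s≤s z≤n) 2≤legs))) ⟩
          suc (suc (legs v ∸ 1))            ≡⟨ cong (suc ∘ suc) (sym hits≡) ⟩
          length (w₁ ∷ w₂ ∷ hitLegs S v)    ≤⟨ Unique⇒length≤ _≟_ !all all⊆legs ⟩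
          legs v                            ∎))
        where
          open ≤-Reasoning
          ∈legs : ∀ {w} → Leg v w → w ∈ legList v
          ∈legs leg = ∈-filter⁺ (Leg? v) (proj₁ leg) leg
          2≤legs : 2 ≤ legs v
          2≤legs = Unique⇒length≤ _≟_ ((w₁≢w₂ ∷ []) ∷ [] ∷ [])
                     λ { (here refl) → ∈legs leg₁ ; (there (here refl)) → ∈legs leg₂ }
          clause = at-branching v (legs v) (legs-NumBranchPaths v) 2≤legs
          hits≡ : length (hitLegs S v) ≡ legs v ∸ 1
          hits≡ = trans (hitLegs-length S v) (sym (Count⇒≡count (OnBranchPath? v) (proj₁ clause)))
          missed : ∀ {w} → ¬ MeetsBranch S v w → All (w ≢_) (hitLegs S v)
          missed ¬meets = All.tabulate λ w′∈ w≡w′ → ¬meets (subst (MeetsBranch S v) (sym w≡w′) (proj₂ (hitLegs-Leg w′∈)))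
          !all : Unique (w₁ ∷ w₂ ∷ hitLegs S v)
          !all = (w₁≢w₂ ∷ missed ¬meets₁) ∷ missed ¬meets₂ ∷ OnDistinctLegs⇒hitLegs-unique !S (proj₂ clause)
          all⊆legs : w₁ ∷ w₂ ∷ hitLegs S v ⊆ legList v
          all⊆legs (here refl) = ∈legs leg₁
          all⊆legs (there (here refl)) = ∈legs leg₂
          all⊆legs (there (there w∈)) = ∈legs (proj₁ (hitLegs-Leg {S} w∈))

      Constructed⇒Resolving : ∀ {S} → Constructed G S → Resolving G S
      Constructed⇒Resolving c = BranchResolving⇒Resolving (proj₂ (BranchResolving⇒nonempty res)) res
        where res = LegResolving⇒BranchResolving (Constructed⇒LegResolving c)

      Constructed⇒length : ∀ {S} → Constructed G S → length S ≡ legSum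
      Constructed⇒length {S} (_ , at-branching , on-branching) = length≡legSum onSomeLeg exact
        where
          onSomeLeg : ∀ {u} → u ∈ S → Any (λ v → OnBranchPath G v u) majors
          onSomeLeg u∈ with on-branching _ u∈
          ... | v , k , #legs , 2≤k , on =
            lose (majors-complete (two-legs⇒Major major₀ (subst (2 ≤_) (NumBranchPaths⇒≡legs #legs) 2≤k))) on
          exact : ∀ {v} → v ∈ majors → count (OnBranchPath? v) S ≡ legs v ∸ 1
          exact {v} v∈ with 2 ≤? legs v
          ... | yes 2≤legs = sym (Count⇒≡count (OnBranchPath? v) (proj₁ (at-branching v _ (legs-NumBranchPaths v) 2≤legs)))
          ... | no ≱2 = trans (cong length (filter-none (OnBranchPath? v) (All.tabulate none))) (sym (m≤n⇒m∸n≡0 (≤-pred (≰⇒> ≱2))))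
            where
              none : ∀ {u} → u ∈ S → ¬ OnBranchPath G v u
              none u∈ on with on-branching _ u∈
              ... | v′ , k , #legs , 2≤k , on′ with subst (2 ≤_) (NumBranchPaths⇒≡legs #legs) 2≤k
              ...   | 2≤legs′ with legs-disjoint (majors-sound v∈) (two-legs⇒Major major₀ 2≤legs′) on on′
              ...     | refl = ≱2 2≤legs′

      Constructed⇒MetricBasis : ∀ {S} → Constructed G S → MetricBasis G S
      Constructed⇒MetricBasis c@(!S , _) = !S , Constructed⇒Resolving c ,
        λ S′ _ res′ → subst (_≤ length S′) (sym (Constructed⇒length c)) (legSum≤ (Resolving⇒BranchResolving res′))

      canonical-Constructed : Constructed G canonical
      canonical-Constructed = canonical-unique , at-branching , on-branching
        where
          at-branching : ∀ v k → NumBranchPaths G v k → 2 ≤ k →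
                         Count G (OnBranchPath G v) canonical (k ∸ 1) × OnDistinctLegs canonical v
          at-branching v k #legs 2≤k = subst (Count G (OnBranchPath G v) canonical) count≡ (count-Count (OnBranchPath? v) canonical)
                                     , distinct
            where
              k≡ = NumBranchPaths⇒≡legs #legs
              major = two-legs⇒Major major₀ (subst (2 ≤_) k≡ 2≤k)
              count≡ : count (OnBranchPath? v) canonical ≡ k ∸ 1
              count≡ = trans (canonical-count major) (cong (_∸ 1) (sym k≡))
              foot : ∀ {u w} → u ∈ canonical → w ∈ nb v → BranchPath G v w → InBranch G v w u → w ≡ u
              foot {u} u∈ v~w path reach = trans (sym (towards-Beyond⁻ v~w (ReachAvoid⇒Beyond v~w reach)))
                                                 (towards-Beyond⁻ v~u (Beyond-self v~u))
                where
                  v~u = proj₁ (legList-Leg (spareLegs⊆legList (canonical-at u∈ major (_ , v~w , path , reach))))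
              distinct : OnDistinctLegs canonical v
              distinct u u′ w w′ u∈ u′∈ u≢u′ v~w v~w′ path path′ reach reach′ w≡w′ =
                u≢u′ (trans (sym (foot u∈ v~w path reach)) (trans w≡w′ (foot u′∈ v~w′ path′ reach′)))
          on-branching : ∀ u → u ∈ canonical → ∃ λ v → ∃ λ k → NumBranchPaths G v k × 2 ≤ k × OnBranchPath G v u
          on-branching u u∈ with ∈canonical⁻ u∈
          ... | v , _ , u∈v = v , legs v , legs-NumBranchPaths v , spareLegs⇒2≤legs u∈v , spareLegs-OnBranchPath u∈v

      canonical-MetricBasis : MetricBasis G canonical
      canonical-MetricBasis = Constructed⇒MetricBasis canonical-Constructed

      canonical-Resolving : Resolving G canonical
      canonical-Resolving = Constructed⇒Resolving canonical-Constructed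

      canonical-length : length canonical ≡ legSum
      canonical-length = Constructed⇒length canonical-Constructed

      MetricBasis⇒length : ∀ {S} → MetricBasis G S → length S ≡ legSum
      MetricBasis⇒length (_ , res , minimal) = ≤-antisym
        (≤-trans (minimal canonical canonical-unique canonical-Resolving) (≤-reflexive canonical-length))
        (legSum≤ (Resolving⇒BranchResolving res))

      -- A basis has exactly legSum vertices, so every bound in legSum≤ is attained.
      MetricBasis⇒exact : ∀ {S} → MetricBasis G S → ∀ {v} → v ∈ majors → legs v ∸ 1 ≡ count (OnBranchPath? v) S
      MetricBasis⇒exact {S} basis@(_ , res , _) = sum-map-tight majors
        (λ _ → LegResolving⇒onLegs (BranchResolving⇒LegResolving (Resolving⇒BranchResolving res) _)) (begin
          sum (map (λ v → count (OnBranchPath? v) S) majors)  ≡⟨ legCounts-sum S ⟩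
          count OnSomeLeg? S                                  ≤⟨ length-filter OnSomeLeg? S ⟩
          length S                                            ≡⟨ MetricBasis⇒length basis ⟩
          legSum                                              ∎)
        where open ≤-Reasoning

      MetricBasis⇒onSomeLeg : ∀ {S} → MetricBasis G S → ∀ {u} → u ∈ S → Any (λ v → OnBranchPath G v u) majors
      MetricBasis⇒onSomeLeg {S} basis = count≡length⇒all OnSomeLeg? (≤-antisym (length-filter OnSomeLeg? S) (begin
          length S                                            ≡⟨ MetricBasis⇒length basis ⟩
          legSum                                              ≡⟨ sum-map-cong majors (MetricBasis⇒exact basis) ⟩
          sum (map (λ v → count (OnBranchPath? v) S) majors)  ≡⟨ legCounts-sum S ⟩
          count OnSomeLeg? S                                  ∎))
        where open ≤-Reasoning

      -- hitLegs S v has length legs v ∸ 1, which already bounds the legs met by S from below.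
      MetricBasis⇒hitLegs-unique : ∀ {S v} → MetricBasis G S → v ∈ majors → Unique (hitLegs S v)
      MetricBasis⇒hitLegs-unique {S} {v} basis@(_ , res , _) v∈ = length-minimal⇒Unique _≟_ (hitLegs S v) λ ys hits⊆ys → begin
          length (hitLegs S v)                  ≡⟨ trans (hitLegs-length S v) (sym (MetricBasis⇒exact basis v∈)) ⟩
          legs v ∸ 1                            ≤⟨ LegResolving⇒met (BranchResolving⇒LegResolving (Resolving⇒BranchResolving res) v) ⟩
          count (MeetsBranch? S v) (legList v)  ≤⟨ Unique⇒length≤ _≟_ (Unique.filter⁺ (MeetsBranch? S v) (legList-unique v))
                                                                       (hits⊆ys ∘ metLegs⊆hitLegs S v) ⟩
          length ys                             ∎
        where open ≤-Reasoning

      MetricBasis⇒at-branching : ∀ {S} → MetricBasis G S → ∀ v k → NumBranchPaths G v k → 2 ≤ k →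
                                 Count G (OnBranchPath G v) S (k ∸ 1) × OnDistinctLegs S v
      MetricBasis⇒at-branching {S} basis v k #legs 2≤k =
        subst (Count G (OnBranchPath G v) S) count≡ (count-Count (OnBranchPath? v) S) ,
        hitLegs-unique⇒OnDistinctLegs (MetricBasis⇒hitLegs-unique basis v∈)
        where
          k≡ : k ≡ legs v
          k≡ = NumBranchPaths⇒≡legs #legs
          v∈ : v ∈ majors
          v∈ = majors-complete (two-legs⇒Major major₀ (subst (2 ≤_) k≡ 2≤k))
          count≡ : count (OnBranchPath? v) S ≡ k ∸ 1
          count≡ = trans (sym (MetricBasis⇒exact basis v∈)) (cong (_∸ 1) (sym k≡))

      MetricBasis⇒on-branching : ∀ {S} → MetricBasis G S → ∀ u → u ∈ S →
                                 ∃ λ v → ∃ λ k → NumBranchPaths G v k × 2 ≤ k × OnBranchPath G v u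
      MetricBasis⇒on-branching {S} basis u u∈ =
        let (v , v∈ , on) = find (MetricBasis⇒onSomeLeg basis u∈) in
        v , legs v , legs-NumBranchPaths v , 2≤legs v∈ on , on
        where
          2≤legs : ∀ {v} → v ∈ majors → OnBranchPath G v u → 2 ≤ legs v
          2≤legs {v} v∈ on with 2 ≤? legs v
          ... | yes 2≤ = 2≤
          ... | no ≱2 = ⊥-elim (count≡0⇒none (OnBranchPath? v) {xs = S}
                          (trans (sym (MetricBasis⇒exact basis v∈)) (m≤n⇒m∸n≡0 (≤-pred (≰⇒> ≱2)))) u∈ on)

      MetricBasis⇒Constructed : ∀ {S} → MetricBasis G S → Constructed G S
      MetricBasis⇒Constructed basis = proj₁ basis , MetricBasis⇒at-branching basis , MetricBasis⇒on-branching basis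

theorem4 : (G : Graph) → IsTree G → InfiniteGraph G →
           (∃ λ v → 3 ≤ deg G v) → FiniteMetricDim G →
           (Σ (List (Graph.V G)) λ L → Σ ℕ λ n →
              Unique L ×
              (∀ v k → 3 ≤ deg G v → NumBranchPaths G v k → 2 ≤ k → v ∈ L) ×
              BranchSum G L n × MetricDim G n) ×
           (∀ S → MetricBasis G S ⇔ Constructed G S)
theorem4 G (conn , acyc) _ (y₀ , major₀) (R , _ , R-res) =
  (majors , legSum , majors-unique , (λ _ _ major _ _ → majors-complete major) , majors-BranchSum ,
   canonical , canonical-MetricBasis , canonical-length) ,
  λ S → mk⇔ MetricBasis⇒Constructed Constructed⇒MetricBasis
  where
    open TreeMetric G conn acyc
    open FiniteMajors R (Resolving⇒BranchResolving R-res)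
    open Characterisation major₀
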